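{- Consider the sequential hiring problem: there are $n$ candidates, candidate $i$ having value $v_i\ge 0$ and acceptance probability $p_i\in[0,1]$, with acceptances independent across candidates. There are $k$ positions and a deadline of $t$ time steps. At each time step the decision maker may make one offer to a candidate not yet offered, who accepts with probability $p_i$; an accepting candidate is hired irrevocably, and once $k$ candidates have been hired no more offers are made. The value of a strategy is the expected sum of values of hired candidates. Let $\mathrm{OPT}$ be the maximum expected value over all (adaptive) strategies. Then there exists a non-adaptive strategy, i.e. a fixed ordered list of at most $t$ distinct candidates to whom offers are made in that order until $k$ have accepted or the list is exhausted, whose expected value is at least $\frac12\mathrm{OPT}$.
   Context: An adaptive strategy may choose each next offer based on the outcomes of all previous offers.
   Formalization: The candidate values $v_i$ and acceptance probabilities $p_i$ are taken in the rationals. -}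

module Defs where

open import Data.Nat using (ℕ; zero; suc)
open import Data.Fin using (Fin)
open import Data.List using (List; []; _∷_)
open import Data.List.Membership.Propositional using (_∉_)
open import Data.Product using (_×_)
open import Data.Unit using (⊤)
open import Data.Rational using (ℚ; 0ℚ; 1ℚ; _+_; _*_; _-_)

-- An (adaptive, deterministic) strategy for the hiring problem with n
-- candidates: a decision tree.  At each time step the decision maker either
--   * stops forever           (stop),
--   * idles for this step     (idle s),
--   * offers to candidate i   (offer i sA sR), continuing with sA if i
--     accepts and with sR if i rejects.
data Strategy (n : ℕ) : Set where
  stop  : Strategy n
  idle  : Strategy n → Strategy n
  offer : Fin n → Strategy n → Strategy n → Strategy n

Valid : {n : ℕ} → List (Fin n) → Strategy n → Set
Valid used stop          = ⊤
Valid used (idle s)      = Valid used s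
Valid used (offer i a r) = (i ∉ used) × Valid (i ∷ used) a × Valid (i ∷ used) r

-- Expected value of a strategy, with `t` remaining time steps and `k`
-- remaining open positions.
value : {n : ℕ} → (v p : Fin n → ℚ) → (t k : ℕ) → Strategy n → ℚ
value v p zero    k       s             = 0ℚ
value v p (suc t) zero    s             = 0ℚ
value v p (suc t) (suc k) stop          = 0ℚ
value v p (suc t) (suc k) (idle s)      = value v p t (suc k) s
value v p (suc t) (suc k) (offer i a r) =
  p i * (v i + value v p t k a) + (1ℚ - p i) * value v p t (suc k) r

nonAdaptiveValue : {n : ℕ} → (v p : Fin n → ℚ) → (k : ℕ) → List (Fin n) → ℚ
nonAdaptiveValue v p k       []      = 0ℚ
nonAdaptiveValue v p zero    (i ∷ L) = 0ℚ
nonAdaptiveValue v p (suc k) (i ∷ L) =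
  p i * (v i + nonAdaptiveValue v p k L) + (1ℚ - p i) * nonAdaptiveValue v p (suc k) L

{-# OPTIONS --safe #-}
-- Fix a threshold θ ≥ 0 and call p i (v i - θ) the surplus of candidate i.  An adaptive
-- strategy earns at most θ per position plus the surplus of the candidates it offers to
-- (at most t distinct ones, counting only positive surpluses), so OPT ≤ θ k + max_S
-- surplus(S).  Choosing for θ the largest ratio (∑_{i ∈ S} p i v i) / (k + ∑_{i ∈ S} p i)
-- over sets S of at most t candidates makes every surplus(S) at most θ k, with equality
-- at a maximiser S*; hence OPT ≤ 2 θ k.  Offering to the members of S* worth at least θ
-- only raises the surplus, and a list of such candidates with surplus ≥ θ k earns at
-- least θ k: by induction its value dominates Q θ k + (1 - Q) surplus, where Q is the
-- probability that all k positions fill.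
module Submission where

open import Defs
open import Data.Nat using (ℕ)
open import Data.Fin using (Fin)
open import Data.List using (List; []; length)
open import Data.List.Relation.Unary.Unique.Propositional using (Unique)
open import Data.Product using (Σ; _×_)
open import Data.Rational using (ℚ; 0ℚ; 1ℚ; ½; _*_; _≤_)

open import Data.Nat using (zero; suc; z≤n; s≤s)
import Data.Nat as ℕ
import Data.Nat.Properties as ℕP
import Data.Fin as Fin
open import Data.List using (_∷_; [_]; allFin; filter; cartesianProductWith)
open import Data.List.Properties using (length-filter)
open import Data.List.Membership.Propositional using (_∈_; _∉_)
open import Data.List.Membership.Propositional.Properties
  using (∈-allFin; ∈-cartesianProductWith⁺; ∈-filter⁺)
open import Data.List.Relation.Unary.Any using (here; there)
open import Data.List.Relation.Unary.All as All using (All; []; _∷_)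
open import Data.List.Relation.Unary.All.Properties using (all-filter)
open import Data.List.Relation.Unary.AllPairs using ([]; _∷_)
import Data.List.Relation.Unary.Unique.Propositional.Properties as Unique
import Data.List.Relation.Unary.Unique.DecPropositional as UniqueDec
open import Data.Product using (_,_; proj₁; proj₂)
open import Data.Rational using (_+_; _-_; -_; _<_; 1/_; NonZero; nonNegative; positive)
open import Data.Rational.Properties as ℚP
  using (_≤?_; ≤-refl; ≤-trans; ≤-reflexive; ≤-decTotalOrder)
open import Data.Rational.Solver using (module +-*-Solver)
open +-*-Solver using (solve; _:+_; _:-_; _:*_; _:=_; con)
open import Relation.Binary.Bundles using (DecTotalOrder)
open import Relation.Binary.PropositionalEquality
  using (_≡_; _≢_; refl; sym; trans; cong; subst; subst₂; module ≡-Reasoning)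
open import Relation.Nullary using (¬_; yes; no; _×-dec_)
open import Relation.Unary using (Decidable)

open import Data.List.Extrema (DecTotalOrder.totalOrder ≤-decTotalOrder) using
  (argmax; argmax-all; f[⊥]≤f[argmax]; f[xs]≤f[argmax])

p≤q⇒0≤q-p : ∀ {p q} → p ≤ q → 0ℚ ≤ q - p
p≤q⇒0≤q-p {p} {q} p≤q =
  subst (_≤ q - p) (ℚP.+-inverseʳ p) (ℚP.+-monoˡ-≤ (- p) p≤q)

0≤q-p⇒p≤q : ∀ {p q} → 0ℚ ≤ q - p → p ≤ q
0≤q-p⇒p≤q {p} {q} 0≤q-p = subst₂ _≤_
  (ℚP.+-identityʳ p) (solve 2 (λ p q → p :+ (q :- p) := q) refl p q)
  (ℚP.+-monoʳ-≤ p 0≤q-p)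

≤-fromDiff : ∀ {p q} r → q - p ≡ r → 0ℚ ≤ r → p ≤ q
≤-fromDiff r q-p≡r 0≤r = 0≤q-p⇒p≤q (subst (0ℚ ≤_) (sym q-p≡r) 0≤r)

0≤p*q : ∀ {p q} → 0ℚ ≤ p → 0ℚ ≤ q → 0ℚ ≤ p * q
0≤p*q {p} {q} 0≤p 0≤q = ℚP.nonNegative⁻¹ (p * q)
  {{ℚP.nonNeg*nonNeg⇒nonNeg p {{nonNegative 0≤p}} q {{nonNegative 0≤q}}}}

-- Recursive rather than via ℤ, so that the ring solver sees fromℕ (suc k) as 1 + fromℕ k.
fromℕ : ℕ → ℚ
fromℕ zero    = 0ℚ
fromℕ (suc k) = 1ℚ + fromℕ k

0≤fromℕ : ∀ k → 0ℚ ≤ fromℕ k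
0≤fromℕ zero    = ≤-refl
0≤fromℕ (suc k) = ℚP.+-mono-≤ (ℚP.nonNegative⁻¹ 1ℚ) (0≤fromℕ k)

module _ {A : Set} where

  ∑ : (A → ℚ) → List A → ℚ
  ∑ f []       = 0ℚ
  ∑ f (x ∷ xs) = f x + ∑ f xs

  ∑-nonNeg : ∀ {f} → (∀ x → 0ℚ ≤ f x) → ∀ xs → 0ℚ ≤ ∑ f xs
  ∑-nonNeg 0≤f []       = ≤-refl
  ∑-nonNeg 0≤f (x ∷ xs) = ℚP.+-mono-≤ (0≤f x) (∑-nonNeg 0≤f xs)

  ∑≤∑-filter : ∀ {P : A → Set} (P? : Decidable P) {f} →
               (∀ x → ¬ P x → f x ≤ 0ℚ) → ∀ xs → ∑ f xs ≤ ∑ f (filter P? xs)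
  ∑≤∑-filter P? f≤0 [] = ≤-refl
  ∑≤∑-filter P? {f} f≤0 (x ∷ xs) with P? x
  ... | yes _  = ℚP.+-monoʳ-≤ (f x) (∑≤∑-filter P? f≤0 xs)
  ... | no ¬Px = begin
    f x + ∑ f xs  ≤⟨ ℚP.+-monoˡ-≤ (∑ f xs) (f≤0 x ¬Px) ⟩
    0ℚ + ∑ f xs   ≡⟨ ℚP.+-identityˡ (∑ f xs) ⟩
    ∑ f xs        ≤⟨ ∑≤∑-filter P? f≤0 xs ⟩
    ∑ f (filter P? xs) ∎
    where open ℚP.≤-Reasoning

  ∉-head : ∀ {x y : A} {ys} → x ∉ y ∷ ys → y ≢ x
  ∉-head x∉y∷ys y≡x = x∉y∷ys (here (sym y≡x))

  ∉-tail : ∀ {x y : A} {ys} → x ∉ y ∷ ys → x ∉ ys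
  ∉-tail x∉y∷ys x∈ys = x∉y∷ys (there x∈ys)

  Admissible : ℕ → List A → Set
  Admissible t S = Unique S × length S ℕ.≤ t

listsUpTo : (n t : ℕ) → List (List (Fin n))
listsUpTo n zero    = [ [] ]
listsUpTo n (suc t) = [] ∷ cartesianProductWith _∷_ (allFin n) (listsUpTo n t)

∈-listsUpTo : ∀ {n t} (S : List (Fin n)) → length S ℕ.≤ t → S ∈ listsUpTo n t
∈-listsUpTo {t = zero}  []      _         = here refl
∈-listsUpTo {t = suc t} []      _         = here refl
∈-listsUpTo {t = suc t} (i ∷ S) (s≤s |S|≤t) =
  there (∈-cartesianProductWith⁺ _∷_ (∈-allFin i) (∈-listsUpTo S |S|≤t))

admissible? : ∀ {n} t → Decidable (Admissible {Fin n} t)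
admissible? t S = UniqueDec.unique? Fin._≟_ S ×-dec (length S ℕ.≤? t)

value-noPositions : ∀ {n} (v p : Fin n → ℚ) t s → value v p t zero s ≡ 0ℚ
value-noPositions v p zero    s = refl
value-noPositions v p (suc t) s = refl

module Hiring {n : ℕ} (v p : Fin n → ℚ) (p∈[0,1] : ∀ i → 0ℚ ≤ p i × p i ≤ 1ℚ) where

  private
    0≤p : ∀ i → 0ℚ ≤ p i
    0≤p i = proj₁ (p∈[0,1] i)

    0≤1-p : ∀ i → 0ℚ ≤ 1ℚ - p i
    0≤1-p i = p≤q⇒0≤q-p (proj₂ (p∈[0,1] i))

  surplus : ℚ → List (Fin n) → ℚ
  surplus θ = ∑ (λ i → p i * (v i - θ))

  surplus-split : ∀ θ S → surplus θ S ≡ ∑ (λ i → p i * v i) S - θ * ∑ p S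
  surplus-split θ []      = solve 1 (λ θ → con 0ℚ := con 0ℚ :- θ :* con 0ℚ) refl θ
  surplus-split θ (i ∷ S) = trans (cong (p i * (v i - θ) +_) (surplus-split θ S))
    (solve 5 (λ pᵢ vᵢ θ G P → pᵢ :* (vᵢ :- θ) :+ (G :- θ :* P)
                            := pᵢ :* vᵢ :+ G :- θ :* (pᵢ :+ P))
      refl (p i) (v i) θ (∑ (λ j → p j * v j) S) (∑ p S))

  surplus≤surplus-filter : ∀ θ S → surplus θ S ≤ surplus θ (filter (λ i → θ ≤? v i) S)
  surplus≤surplus-filter θ = ∑≤∑-filter (λ i → θ ≤? v i) p*[v-θ]≤0
    where
    p*[v-θ]≤0 : ∀ i → ¬ θ ≤ v i → p i * (v i - θ) ≤ 0ℚ
    p*[v-θ]≤0 i θ≰vᵢ = ≤-fromDiff (p i * (θ - v i))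
      (solve 3 (λ pᵢ vᵢ θ → con 0ℚ :- pᵢ :* (vᵢ :- θ) := pᵢ :* (θ :- vᵢ))
        refl (p i) (v i) θ)
      (0≤p*q (0≤p i) (p≤q⇒0≤q-p (ℚP.<⇒≤ (ℚP.≰⇒> θ≰vᵢ))))

  fillProbability : ℕ → List (Fin n) → ℚ
  fillProbability zero    L       = 1ℚ
  fillProbability (suc k) []      = 0ℚ
  fillProbability (suc k) (i ∷ L) =
    p i * fillProbability k L + (1ℚ - p i) * fillProbability (suc k) L

  fillProbability∈[0,1] : ∀ k L → 0ℚ ≤ fillProbability k L × fillProbability k L ≤ 1ℚ
  fillProbability∈[0,1] zero    L       = ℚP.nonNegative⁻¹ 1ℚ , ≤-refl
  fillProbability∈[0,1] (suc k) []      = ≤-refl , ℚP.nonNegative⁻¹ 1ℚ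
  fillProbability∈[0,1] (suc k) (i ∷ L) =
    ℚP.+-mono-≤ (0≤p*q (0≤p i) 0≤Q₀) (0≤p*q (0≤1-p i) 0≤Q₁) ,
    ≤-fromDiff _
      (solve 3 (λ pᵢ Q₀ Q₁ → con 1ℚ :- (pᵢ :* Q₀ :+ (con 1ℚ :- pᵢ) :* Q₁)
                          := pᵢ :* (con 1ℚ :- Q₀) :+ (con 1ℚ :- pᵢ) :* (con 1ℚ :- Q₁))
        refl (p i) (fillProbability k L) (fillProbability (suc k) L))
      (ℚP.+-mono-≤ (0≤p*q (0≤p i) (p≤q⇒0≤q-p Q₀≤1))
                   (0≤p*q (0≤1-p i) (p≤q⇒0≤q-p Q₁≤1)))
    where
    0≤Q₀ = proj₁ (fillProbability∈[0,1] k L)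
    Q₀≤1 = proj₂ (fillProbability∈[0,1] k L)
    0≤Q₁ = proj₁ (fillProbability∈[0,1] (suc k) L)
    Q₁≤1 = proj₂ (fillProbability∈[0,1] (suc k) L)

  module _ (θ : ℚ) (0≤θ : 0ℚ ≤ θ) where

    SurplusBound : ℚ → List (Fin n) → ℕ → Set
    SurplusBound c U t = ∀ S → All (_∉ U) S → Admissible t S → surplus θ S ≤ c

    surplusBound-idle : ∀ {c U t} → SurplusBound c U (suc t) → SurplusBound c U t
    surplusBound-idle B S S∉U (unique-S , |S|≤t) =
      B S S∉U (unique-S , ℕP.m≤n⇒m≤1+n |S|≤t)

    -- An offer to i with nonnegative surplus is charged to the budget, since any
    -- later offer set can be extended by i; otherwise i is simply forgotten.
    surplusBound-offer : ∀ {c U t i} → i ∉ U → SurplusBound c U (suc t) →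
      Σ ℚ λ c′ → SurplusBound c′ (i ∷ U) t × c′ + p i * (v i - θ) ≤ c
    surplusBound-offer {c} {U} {t} {i} i∉U B with 0ℚ ≤? p i * (v i - θ)
    ... | yes _ = c - wᵢ , B′ , ≤-reflexive (solve 2 (λ c w → c :- w :+ w := c) refl c wᵢ)
      where
      wᵢ = p i * (v i - θ)
      B′ : SurplusBound (c - wᵢ) (i ∷ U) t
      B′ S S∉iU (unique-S , |S|≤t) = ≤-fromDiff _
        (solve 3 (λ c w x → c :- w :- x := c :- (w :+ x)) refl c wᵢ (surplus θ S))
        (p≤q⇒0≤q-p (B (i ∷ S) (i∉U ∷ All.map ∉-tail S∉iU)
          (All.map ∉-head S∉iU ∷ unique-S , s≤s |S|≤t)))
    ... | no wᵢ≱0 = c , B′ , c+wᵢ≤c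
      where
      c+wᵢ≤c : c + p i * (v i - θ) ≤ c
      c+wᵢ≤c = begin
        c + p i * (v i - θ) ≤⟨ ℚP.+-monoʳ-≤ c (ℚP.<⇒≤ (ℚP.≰⇒> wᵢ≱0)) ⟩
        c + 0ℚ              ≡⟨ ℚP.+-identityʳ c ⟩
        c                   ∎
        where open ℚP.≤-Reasoning
      B′ : SurplusBound c (i ∷ U) t
      B′ S S∉iU (unique-S , |S|≤t) =
        B S (All.map ∉-tail S∉iU) (unique-S , ℕP.m≤n⇒m≤1+n |S|≤t)

    0≤θk+c : ∀ {c U t} k → SurplusBound c U t → 0ℚ ≤ θ * fromℕ k + c
    0≤θk+c k B = ℚP.+-mono-≤ (0≤p*q 0≤θ (0≤fromℕ k)) (B [] [] ([] , z≤n))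

    offer-step : ∀ i k {c Vᵃ Vʳ} →
      Vᵃ ≤ θ * fromℕ k + c → Vʳ ≤ θ * fromℕ (suc k) + c →
      p i * (v i + Vᵃ) + (1ℚ - p i) * Vʳ ≤ θ * fromℕ (suc k) + (c + p i * (v i - θ))
    offer-step i k {c} {Vᵃ} {Vʳ} Vᵃ≤ Vʳ≤ = ≤-fromDiff _
      (solve 7 (λ θ pᵢ vᵢ K c Vᵃ Vʳ →
          θ :* (con 1ℚ :+ K) :+ (c :+ pᵢ :* (vᵢ :- θ))
            :- (pᵢ :* (vᵢ :+ Vᵃ) :+ (con 1ℚ :- pᵢ) :* Vʳ)
        := pᵢ :* (θ :* K :+ c :- Vᵃ) :+ (con 1ℚ :- pᵢ) :* (θ :* (con 1ℚ :+ K) :+ c :- Vʳ))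
        refl θ (p i) (v i) (fromℕ k) c Vᵃ Vʳ)
      (ℚP.+-mono-≤ (0≤p*q (0≤p i) (p≤q⇒0≤q-p Vᵃ≤))
                   (0≤p*q (0≤1-p i) (p≤q⇒0≤q-p Vʳ≤)))

    adaptiveValue≤ : ∀ {c U} t k s → Valid U s → SurplusBound c U t →
      value v p t k s ≤ θ * fromℕ k + c
    adaptiveValue≤ zero    k       s        _ B = 0≤θk+c k B
    adaptiveValue≤ (suc t) zero    s        _ B = 0≤θk+c zero B
    adaptiveValue≤ (suc t) (suc k) stop     _ B = 0≤θk+c (suc k) B
    adaptiveValue≤ (suc t) (suc k) (idle s) valid B =
      adaptiveValue≤ t (suc k) s valid (surplusBound-idle B)
    adaptiveValue≤ (suc t) (suc k) (offer i a r) (i∉U , valid-a , valid-r) B =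
      let c′ , B′ , c′+wᵢ≤c = surplusBound-offer i∉U B
      in ≤-trans
           (offer-step i k (adaptiveValue≤ t k a valid-a B′)
                           (adaptiveValue≤ t (suc k) r valid-r B′))
           (ℚP.+-monoʳ-≤ (θ * fromℕ (suc k)) c′+wᵢ≤c)

    nonAdaptiveValue≥ : ∀ k L → All (λ i → θ ≤ v i) L →
      θ * fromℕ k * fillProbability k L + (1ℚ - fillProbability k L) * surplus θ L
        ≤ nonAdaptiveValue v p k L
    nonAdaptiveValue≥ zero [] _ = ≤-reflexive
      (solve 1 (λ θ → θ :* con 0ℚ :* con 1ℚ :+ (con 1ℚ :- con 1ℚ) :* con 0ℚ := con 0ℚ)
        refl θ)
    nonAdaptiveValue≥ zero (i ∷ L) _ = ≤-reflexive
      (solve 2 (λ θ W → θ :* con 0ℚ :* con 1ℚ :+ (con 1ℚ :- con 1ℚ) :* W := con 0ℚ)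
        refl θ (surplus θ (i ∷ L)))
    nonAdaptiveValue≥ (suc k) [] _ = ≤-reflexive
      (solve 1 (λ θk → θk :* con 0ℚ :+ (con 1ℚ :- con 0ℚ) :* con 0ℚ := con 0ℚ)
        refl (θ * fromℕ (suc k)))
    nonAdaptiveValue≥ (suc k) (i ∷ L) (θ≤vᵢ ∷ θ≤v) =
      ≤-fromDiff _ decomposition (ℚP.+-mono-≤ (ℚP.+-mono-≤ accepted rejected) slack)
      where
      K  = fromℕ k
      Q₀ = fillProbability k L
      Q₁ = fillProbability (suc k) L
      Q  = fillProbability (suc k) (i ∷ L)
      W  = surplus θ L
      N₀ = nonAdaptiveValue v p k L
      N₁ = nonAdaptiveValue v p (suc k) L
      R₀ = θ * K * Q₀ + (1ℚ - Q₀) * W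
      R₁ = θ * (1ℚ + K) * Q₁ + (1ℚ - Q₁) * W

      accepted : 0ℚ ≤ p i * (N₀ - R₀)
      accepted = 0≤p*q (0≤p i) (p≤q⇒0≤q-p (nonAdaptiveValue≥ k L θ≤v))

      rejected : 0ℚ ≤ (1ℚ - p i) * (N₁ - R₁)
      rejected = 0≤p*q (0≤1-p i) (p≤q⇒0≤q-p (nonAdaptiveValue≥ (suc k) L θ≤v))

      slack : 0ℚ ≤ p i * (θ * (1ℚ - Q₀) + Q * (v i - θ))
      slack = 0≤p*q (0≤p i) (ℚP.+-mono-≤
        (0≤p*q 0≤θ (p≤q⇒0≤q-p (proj₂ (fillProbability∈[0,1] k L))))
        (0≤p*q (proj₁ (fillProbability∈[0,1] (suc k) (i ∷ L))) (p≤q⇒0≤q-p θ≤vᵢ)))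

      decomposition :
        nonAdaptiveValue v p (suc k) (i ∷ L)
          - (θ * (1ℚ + K) * Q + (1ℚ - Q) * (p i * (v i - θ) + W))
        ≡ p i * (N₀ - R₀) + (1ℚ - p i) * (N₁ - R₁)
          + p i * (θ * (1ℚ - Q₀) + Q * (v i - θ))
      decomposition = solve 9 (λ θ pᵢ vᵢ K Q₀ Q₁ W N₀ N₁ →
          let Q = pᵢ :* Q₀ :+ (con 1ℚ :- pᵢ) :* Q₁ in
          pᵢ :* (vᵢ :+ N₀) :+ (con 1ℚ :- pᵢ) :* N₁
            :- (θ :* (con 1ℚ :+ K) :* Q :+ (con 1ℚ :- Q) :* (pᵢ :* (vᵢ :- θ) :+ W))
        := pᵢ :* (N₀ :- (θ :* K :* Q₀ :+ (con 1ℚ :- Q₀) :* W))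
           :+ (con 1ℚ :- pᵢ)
              :* (N₁ :- (θ :* (con 1ℚ :+ K) :* Q₁ :+ (con 1ℚ :- Q₁) :* W))
           :+ pᵢ :* (θ :* (con 1ℚ :- Q₀) :+ Q :* (vᵢ :- θ)))
        refl θ (p i) (v i) K Q₀ Q₁ W N₀ N₁

    θk≤nonAdaptiveValue : ∀ k L → All (λ i → θ ≤ v i) L →
      θ * fromℕ k ≤ surplus θ L → θ * fromℕ k ≤ nonAdaptiveValue v p k L
    θk≤nonAdaptiveValue k L θ≤v θk≤W = ≤-trans
      (≤-fromDiff _
        (solve 3 (λ θk Q W → θk :* Q :+ (con 1ℚ :- Q) :* W :- θk
                          := (con 1ℚ :- Q) :* (W :- θk))
          refl (θ * fromℕ k) Q (surplus θ L))
        (0≤p*q (p≤q⇒0≤q-p (proj₂ (fillProbability∈[0,1] k L))) (p≤q⇒0≤q-p θk≤W)))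
      (nonAdaptiveValue≥ k L θ≤v)
      where Q = fillProbability k L

  module _ (k : ℕ) where

    denominator : List (Fin n) → ℚ
    denominator S = fromℕ (suc k) + ∑ p S

    0<denominator : ∀ S → 0ℚ < denominator S
    0<denominator S =
      ℚP.+-mono-<-≤ (ℚP.+-mono-<-≤ (ℚP.positive⁻¹ 1ℚ) (0≤fromℕ k))
                    (∑-nonNeg 0≤p S)

    denominator≢0 : ∀ S → NonZero (denominator S)
    denominator≢0 S = ℚP.pos⇒nonZero (denominator S) {{positive (0<denominator S)}}

    1/denominator : List (Fin n) → ℚ
    1/denominator S = (1/ denominator S) {{denominator≢0 S}}

    ratio : List (Fin n) → ℚ
    ratio S = ∑ (λ i → p i * v i) S * 1/denominator S

    ratio*denominator : ∀ S → ratio S * denominator S ≡ ∑ (λ i → p i * v i) S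
    ratio*denominator S = begin
      G * D⁻¹ * D     ≡⟨ ℚP.*-assoc G D⁻¹ D ⟩
      G * (D⁻¹ * D)   ≡⟨ cong (G *_) (ℚP.*-inverseˡ D {{denominator≢0 S}}) ⟩
      G * 1ℚ          ≡⟨ ℚP.*-identityʳ G ⟩
      G               ∎
      where
      open ≡-Reasoning
      G = ∑ (λ i → p i * v i) S
      D = denominator S
      D⁻¹ = 1/denominator S

    surplus≡ : ∀ θ S → surplus θ S ≡ θ * fromℕ (suc k) - (θ - ratio S) * denominator S
    surplus≡ θ S = begin
      surplus θ S
        ≡⟨ surplus-split θ S ⟩
      ∑ (λ i → p i * v i) S - θ * ∑ p S
        ≡⟨ cong (λ G → G - θ * ∑ p S) (sym (ratio*denominator S)) ⟩
      ratio S * denominator S - θ * ∑ p S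
        ≡⟨ regroup (ratio S) θ (fromℕ (suc k)) (∑ p S) ⟩
      θ * fromℕ (suc k) - (θ - ratio S) * denominator S ∎
      where
      open ≡-Reasoning
      regroup : ∀ r θ K P → r * (K + P) - θ * P ≡ θ * K - (θ - r) * (K + P)
      regroup = solve 4 (λ r θ K P → r :* (K :+ P) :- θ :* P
                                  := θ :* K :- (θ :- r) :* (K :+ P)) refl

  record CriticalThreshold (k t : ℕ) : Set where
    field
      θ             : ℚ
      0≤θ           : 0ℚ ≤ θ
      S*            : List (Fin n)
      S*-admissible : Admissible t S*
      surplus-S*    : surplus θ S* ≡ θ * fromℕ k
      surplus≤θk    : ∀ S → Admissible t S → surplus θ S ≤ θ * fromℕ k

  criticalThreshold : ∀ k t → CriticalThreshold (suc k) t
  criticalThreshold k t = record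
    { θ             = θ
    ; 0≤θ           = subst (_≤ θ) (ℚP.*-zeroˡ (1/denominator k []))
                        (f[⊥]≤f[argmax] {f = ratio k} [] candidates)
    ; S*            = S*
    ; S*-admissible = argmax-all (ratio k) ([] , z≤n)
                        (all-filter (admissible? t) (listsUpTo n t))
    ; surplus-S*    = trans (surplus≡ k θ S*)
        (solve 3 (λ θ K D → θ :* K :- (θ :- θ) :* D := θ :* K)
          refl θ (fromℕ (suc k)) (denominator k S*))
    ; surplus≤θk    = λ S adm → ≤-fromDiff _
        (trans (cong (λ x → θ * fromℕ (suc k) - x) (surplus≡ k θ S))
          (solve 2 (λ θK x → θK :- (θK :- x) := x)
            refl (θ * fromℕ (suc k)) ((θ - ratio k S) * denominator k S)))
        (0≤p*q (p≤q⇒0≤q-p (ratio≤θ S adm)) (ℚP.<⇒≤ (0<denominator k S)))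
    }
    where
    candidates : List (List (Fin n))
    candidates = filter (admissible? t) (listsUpTo n t)

    S* : List (Fin n)
    S* = argmax (ratio k) [] candidates

    θ : ℚ
    θ = ratio k S*

    ratio≤θ : ∀ S → Admissible t S → ratio k S ≤ θ
    ratio≤θ S adm = All.lookup (f[xs]≤f[argmax] {f = ratio k} [] candidates)
      (∈-filter⁺ (admissible? t) (∈-listsUpTo S (proj₂ adm)) adm)

mainTheorem2 : (n k t : ℕ) (v p : Fin n → ℚ) →
    (∀ i → 0ℚ ≤ v i) → (∀ i → 0ℚ ≤ p i × p i ≤ 1ℚ) →
    Σ (List (Fin n)) λ L →
      Unique L × Data.Nat._≤_ (length L) t ×
      (∀ (s : Strategy n) → Valid [] s →
        ½ * value v p t k s ≤ nonAdaptiveValue v p k L)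
mainTheorem2 n zero t v p _ _ =
  [] , [] , z≤n , λ s _ → ≤-reflexive (cong (½ *_) (value-noPositions v p t s))
mainTheorem2 n (suc k) t v p _ p∈[0,1] =
  L , Unique.filter⁺ θ≤v? (proj₁ S*-admissible) ,
  ℕP.≤-trans (length-filter θ≤v? S*) (proj₂ S*-admissible) , ½OPT≤NA
  where
  open Hiring v p p∈[0,1]
  open CriticalThreshold (criticalThreshold k t)
  open ℚP.≤-Reasoning

  θ≤v? = λ i → θ ≤? v i
  L = filter θ≤v? S*
  θk = θ * fromℕ (suc k)

  θk≤NA : θk ≤ nonAdaptiveValue v p (suc k) L
  θk≤NA = θk≤nonAdaptiveValue θ 0≤θ (suc k) L (all-filter θ≤v? S*) (begin
    θk                   ≡⟨ sym surplus-S* ⟩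
    surplus θ S*         ≤⟨ surplus≤surplus-filter θ S* ⟩
    surplus θ L          ∎)

  OPT≤2θk : ∀ s → Valid [] s → value v p t (suc k) s ≤ θk + θk
  OPT≤2θk s valid = adaptiveValue≤ θ 0≤θ t (suc k) s valid (λ S _ → surplus≤θk S)

  ½OPT≤NA : ∀ s → Valid [] s → ½ * value v p t (suc k) s ≤ nonAdaptiveValue v p (suc k) L
  ½OPT≤NA s valid = begin
    ½ * value v p t (suc k) s
      ≤⟨ ℚP.*-monoˡ-≤-nonNeg ½ (OPT≤2θk s valid) ⟩
    ½ * (θk + θk)
      ≡⟨ solve 1 (λ x → con ½ :* (x :+ x) := x) refl θk ⟩
    θk
      ≤⟨ θk≤NA ⟩
    nonAdaptiveValue v p (suc k) L ∎
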